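{- Let $t\geq 3$ and $n\geq 3$ be integers, and let $G=C_t\,\Box\, K_n$. Then \[ \gamma_R(G)=\begin{cases} 6\lfloor t/4\rfloor+2r & \text{if } n=3,\ t\equiv r \pmod 4,\ 0\leq r\leq 1,\\ 6\lfloor t/4\rfloor+2r-1 & \text{if } n=3,\ t\equiv r \pmod 4,\ 2\leq r\leq 3,\\ 2t & \text{otherwise (i.e. } n\geq 4). \end{cases} \]
   Context: All graphs are finite and simple. $C_t$ is the cycle on $t$ vertices and $K_n$ the complete graph on $n$ vertices. The Cartesian product $G\,\Box\,H$ has vertex set $V(G)\times V(H)$, with $(u_1,v_1)$ adjacent to $(u_2,v_2)$ iff either $u_1=u_2$ and $v_1v_2\in E(H)$, or $v_1=v_2$ and $u_1u_2\in E(G)$. A Roman dominating function (RDF) of a graph $G=(V,E)$ is a function $f:V\to\{0,1,2\}$ such that every vertex $v$ with $f(v)=0$ has a neighbor $w$ with $f(w)=2$. Its weight is $\sum_{v\in V}f(v)$, and $\gamma_R(G)$ is the minimum weight of an RDF of $G$. -}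

module Defs where

open import Data.Nat using (ℕ; zero; suc; _+_; _*_; _≤_; _∸_; _/_; _%_; _≟_; _≤?_)
open import Relation.Nullary using (yes; no)
open import Data.Nat.ListAction using (sum)
open import Data.Fin using (Fin; toℕ; remQuot)
open import Data.List using (List; map; allFin)
open import Data.Product using (_×_; _,_; ∃; ∃-syntax)
open import Data.Sum using (_⊎_)
open import Relation.Binary.PropositionalEquality using (_≡_; _≢_)

CycleAdj : (t : ℕ) → Fin t → Fin t → Set
CycleAdj t i j = (suc (toℕ i) ≡ toℕ j ⊎ suc (toℕ j) ≡ toℕ i)
               ⊎ ((suc (toℕ i) ≡ t × toℕ j ≡ 0) ⊎ (suc (toℕ j) ≡ t × toℕ i ≡ 0))

CompleteAdj : (n : ℕ) → Fin n → Fin n → Set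
CompleteAdj n i j = i ≢ j

-- Cartesian product G □ H on Fin (m * k), identified with Fin m × Fin k via remQuot
-- (a bijection; its inverse is Data.Fin.combine).
BoxAdj : (m k : ℕ) → (Fin m → Fin m → Set) → (Fin k → Fin k → Set)
       → Fin (m * k) → Fin (m * k) → Set
BoxAdj m k A B x y with remQuot {m} k x | remQuot {m} k y
... | (u₁ , v₁) | (u₂ , v₂) = (u₁ ≡ u₂ × B v₁ v₂) ⊎ (v₁ ≡ v₂ × A u₁ u₂)

-- Functions V → {0,1,2} are Fin N → Fin 3, values read via toℕ.
-- Roman dominating function: every vertex of value 0 has a neighbour of value 2.
IsRDF : (N : ℕ) → (Fin N → Fin N → Set) → (Fin N → Fin 3) → Set
IsRDF N Adj f = ∀ v → toℕ (f v) ≡ 0 → ∃[ w ] (Adj v w × toℕ (f w) ≡ 2)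

weight : (N : ℕ) → (Fin N → Fin 3) → ℕ
weight N f = sum (map (λ v → toℕ (f v)) (allFin N))

IsRomanDominationNumber : (N : ℕ) → (Fin N → Fin N → Set) → ℕ → Set
IsRomanDominationNumber N Adj k =
  (∃[ f ] (IsRDF N Adj f × weight N f ≡ k)) ×
  (∀ f → IsRDF N Adj f → k ≤ weight N f)

CtKn : (t n : ℕ) → Fin (t * n) → Fin (t * n) → Set
CtKn t n = BoxAdj t n (CycleAdj t) (CompleteAdj n)

gammaFormula : (t n : ℕ) → ℕ
gammaFormula t n with n ≟ 3 | t % 4 ≤? 1
... | yes _ | yes _ = 6 * (t / 4) + 2 * (t % 4)
... | yes _ | no _  = 6 * (t / 4) + 2 * (t % 4) ∸ 1
... | no _  | _     = 2 * t

-- Let A i and B i be the numbers of 2s and of 1s in the i-th copy of K_n. Every vertex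
-- of a copy without 2s is labelled 1 or is dominated along the cycle, from the same
-- column of a neighbouring copy; hence A i = 0 forces n ≤ B i + A (i-1) + A (i+1).
-- Discharging around the cycle with the charge 4A ∸ 3 (for n = 3) or A ∸ 1 (for n ≥ 4)
-- turns these local inequalities into 6t ≤ 4·weight, resp. 2t ≤ weight; note that the
-- formula for n = 3 is ⌈3t/2⌉. Both bounds are attained: label one column entirely with
-- 2 (n ≥ 4), resp. give the copies alternately a single 2 and a single 1, where the two
-- 2s flanking each 1 sit in different columns and the 1 sits in the third column (n = 3).
module Submission where

open import Data.Bool using (Bool; true; false; not; if_then_else_)
open import Data.Bool.Properties using (not-injective)
open import Data.Fin using (Fin; zero; suc; toℕ; fromℕ; inject₁; combine; remQuot; _↑ˡ_; _↑ʳ_)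
open import Data.Fin.Patterns using (0F; 1F; 2F)
open import Data.Fin.Properties
  using (toℕ-injective; toℕ-fromℕ; toℕ-inject₁; toℕ<n; remQuot-combine; combine-remQuot; all?)
  renaming (_≟_ to _≟ᶠ_)
open import Data.Fin.Relation.Unary.Top using (view; ‵fromℕ; ‵inject₁; view-fromℕ; view-inject₁)
open import Data.List using (tabulate)
open import Data.List.Properties using (map-tabulate)
import Data.Nat.ListAction as List
open import Data.Nat using (ℕ; zero; suc; _+_; _*_; _∸_; _≤_; z≤n; s≤s; ⌈_/2⌉; _/_; _%_; _≤?_)
open import Data.Nat.DivMod using (m/n≡1+[m∸n]/n)
open import Data.Nat.Properties
open import Algebra.Properties.Semiring.Sum +-*-semiring
  using (sum-syntax; sum-cong-≗; ∑-distrib-+; *-distribˡ-sum; sum-init-last)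
open import Data.Nat.Tactic.RingSolver using (solve-∀)
open import Data.Product using (_×_; _,_; ∃-syntax; uncurry)
open import Data.Sum using (_⊎_; inj₁; inj₂)
open import Function using (_∘_)
open import Relation.Binary.PropositionalEquality
open import Relation.Nullary using (yes; no; contradiction)
open import Relation.Nullary.Decidable using (toWitness; ¬?; _→-dec_; _⊎-dec_)

open import Defs

private
  variable
    m n t : ℕ

sum-tabulate : (h : Fin n → ℕ) → List.sum (tabulate h) ≡ ∑[ i < n ] h i
sum-tabulate {zero} h = refl
sum-tabulate {suc n} h = cong (h zero +_) (sum-tabulate (h ∘ suc))

weight≡∑ : (f : Fin n → Fin 3) → weight n f ≡ ∑[ v < n ] toℕ (f v)
weight≡∑ f = trans (cong List.sum (map-tabulate (λ v → v) (toℕ ∘ f))) (sum-tabulate (toℕ ∘ f))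

∑-const : ∀ n c → ∑[ i < n ] c ≡ n * c
∑-const zero c = refl
∑-const (suc n) c = cong (c +_) (∑-const n c)

∑-mono-≤ : {g h : Fin n → ℕ} → (∀ i → g i ≤ h i) → ∑[ i < n ] g i ≤ ∑[ i < n ] h i
∑-mono-≤ {zero} g≤h = z≤n
∑-mono-≤ {suc n} g≤h = +-mono-≤ (g≤h zero) (∑-mono-≤ (g≤h ∘ suc))

∑≡0⇒≡0 : (h : Fin n → ℕ) → ∑[ i < n ] h i ≡ 0 → ∀ i → h i ≡ 0
∑≡0⇒≡0 h ∑≡0 zero = m+n≡0⇒m≡0 (h zero) ∑≡0
∑≡0⇒≡0 h ∑≡0 (suc i) = ∑≡0⇒≡0 (h ∘ suc) (m+n≡0⇒n≡0 (h zero) ∑≡0) i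

∑-↑ : ∀ m (h : Fin (m + n) → ℕ) →
      ∑[ x < m + n ] h x ≡ ∑[ i < m ] h (i ↑ˡ n) + ∑[ j < n ] h (m ↑ʳ j)
∑-↑ zero h = refl
∑-↑ (suc m) h = trans (cong (h zero +_) (∑-↑ m (h ∘ suc))) (sym (+-assoc (h zero) _ _))

∑-combine : ∀ m (h : Fin (m * n) → ℕ) → ∑[ x < m * n ] h x ≡ ∑[ i < m ] ∑[ j < n ] h (combine i j)
∑-combine zero h = refl
∑-combine {n} (suc m) h =
  trans (∑-↑ n h) (cong (∑[ j < n ] h (j ↑ˡ m * n) +_) (∑-combine m (h ∘ (n ↑ʳ_))))

predᶜ : Fin (suc m) → Fin (suc m)
predᶜ zero = fromℕ _
predᶜ (suc i) = inject₁ i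

sucᶜ : Fin (suc m) → Fin (suc m)
sucᶜ i with view i
... | ‵fromℕ = zero
... | ‵inject₁ j = suc j

sucᶜ-fromℕ : ∀ m → sucᶜ (fromℕ m) ≡ zero
sucᶜ-fromℕ m rewrite view-fromℕ m = refl

sucᶜ-inject₁ : (i : Fin m) → sucᶜ (inject₁ i) ≡ suc i
sucᶜ-inject₁ i rewrite view-inject₁ i = refl

∑-predᶜ : (h : Fin (suc m) → ℕ) → ∑[ i < suc m ] h (predᶜ i) ≡ ∑[ i < suc m ] h i
∑-predᶜ {m} h = trans (+-comm (h (fromℕ m)) _) (sym (sum-init-last h))

∑-sucᶜ : (h : Fin (suc m) → ℕ) → ∑[ i < suc m ] h (sucᶜ i) ≡ ∑[ i < suc m ] h i
∑-sucᶜ {m} h = begin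
  ∑[ i < suc m ] h (sucᶜ i)                             ≡⟨ sum-init-last (h ∘ sucᶜ) ⟩
  ∑[ i < m ] h (sucᶜ (inject₁ i)) + h (sucᶜ (fromℕ m)) ≡⟨ cong₂ _+_ (sum-cong-≗ (cong h ∘ sucᶜ-inject₁))
                                                                      (cong h (sucᶜ-fromℕ m)) ⟩
  ∑[ i < m ] h (suc i) + h zero                         ≡⟨ +-comm _ (h zero) ⟩
  ∑[ i < suc m ] h i                                    ∎
  where open ≡-Reasoning

CycleAdj-predᶜ : (i : Fin (suc m)) → CycleAdj (suc m) i (predᶜ i)
CycleAdj-predᶜ {m} zero = inj₂ (inj₂ (cong suc (toℕ-fromℕ m) , refl))
CycleAdj-predᶜ (suc i) = inj₁ (inj₂ (cong suc (toℕ-inject₁ i)))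

CycleAdj-sucᶜ : (i : Fin (suc m)) → CycleAdj (suc m) i (sucᶜ i)
CycleAdj-sucᶜ {m} i with view i
... | ‵fromℕ = inj₂ (inj₁ (cong suc (toℕ-fromℕ m) , refl))
... | ‵inject₁ j = inj₁ (inj₁ (cong suc (toℕ-inject₁ j)))

CycleAdj⇒sucᶜ⊎predᶜ : (i u : Fin (suc m)) → CycleAdj (suc m) i u → u ≡ sucᶜ i ⊎ u ≡ predᶜ i
CycleAdj⇒sucᶜ⊎predᶜ {m} i u (inj₁ (inj₁ 1+i≡u)) with view i
... | ‵fromℕ = contradiction (toℕ<n u) (<-irrefl (trans (sym 1+i≡u) (cong suc (toℕ-fromℕ m))))
... | ‵inject₁ j = inj₁ (toℕ-injective (trans (sym 1+i≡u) (cong suc (toℕ-inject₁ j))))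
CycleAdj⇒sucᶜ⊎predᶜ (suc i) u (inj₁ (inj₂ 1+u≡i)) =
  inj₂ (toℕ-injective (trans (suc-injective 1+u≡i) (sym (toℕ-inject₁ i))))
CycleAdj⇒sucᶜ⊎predᶜ {m} i u (inj₂ (inj₁ (1+i≡1+m , u≡0))) = inj₁ (begin
  u                 ≡⟨ toℕ-injective u≡0 ⟩
  zero              ≡⟨ sucᶜ-fromℕ m ⟨
  sucᶜ (fromℕ m)    ≡⟨ cong sucᶜ (toℕ-injective (trans (suc-injective 1+i≡1+m) (sym (toℕ-fromℕ m)))) ⟨
  sucᶜ i            ∎)
  where open ≡-Reasoning
CycleAdj⇒sucᶜ⊎predᶜ {m} zero u (inj₂ (inj₂ (1+u≡1+m , _))) =
  inj₂ (toℕ-injective (trans (suc-injective 1+u≡1+m) (sym (toℕ-fromℕ m))))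

RomanDominating : {V : Set} → (V → V → Set) → (V → Fin 3) → Set
RomanDominating Adj f = ∀ v → toℕ (f v) ≡ 0 → ∃[ w ] (Adj v w × toℕ (f w) ≡ 2)

-- BoxAdj m n A B x y unfolds to (A □ B) (remQuot n x) (remQuot n y).
_□_ : (Fin m → Fin m → Set) → (Fin n → Fin n → Set) → Fin m × Fin n → Fin m × Fin n → Set
(A □ B) (u₁ , v₁) (u₂ , v₂) = (u₁ ≡ u₂ × B v₁ v₂) ⊎ (v₁ ≡ v₂ × A u₁ u₂)

module _ {A : Fin m → Fin m → Set} {B : Fin n → Fin n → Set} where

  dominating-combine : (f : Fin (m * n) → Fin 3) →
    IsRDF (m * n) (BoxAdj m n A B) f → RomanDominating (A □ B) (f ∘ uncurry combine)
  dominating-combine f dom (i , j) fij≡0 with dom (combine i j) fij≡0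
  ... | w , adj , fw≡2 =
    remQuot n w ,
    subst (λ p → (A □ B) p (remQuot n w)) (remQuot-combine i j) adj ,
    trans (cong (toℕ ∘ f) (combine-remQuot {m} n w)) fw≡2

  dominating-remQuot : (g : Fin m × Fin n → Fin 3) →
    RomanDominating (A □ B) g → IsRDF (m * n) (BoxAdj m n A B) (g ∘ remQuot n)
  dominating-remQuot g dom x gx≡0 with dom (remQuot n x) gx≡0
  ... | (i , j) , adj , gij≡2 =
    combine i j ,
    subst ((A □ B) (remQuot n x)) (sym (remQuot-combine i j)) adj ,
    trans (cong (toℕ ∘ g) (remQuot-combine i j)) gij≡2

weight-combine : (f : Fin (m * n) → Fin 3) →
  weight (m * n) f ≡ ∑[ i < m ] ∑[ j < n ] toℕ (f (combine i j))
weight-combine {m} f = trans (weight≡∑ f) (∑-combine m (toℕ ∘ f))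

weight-remQuot : (g : Fin m × Fin n → Fin 3) →
  weight (m * n) (g ∘ remQuot n) ≡ ∑[ i < m ] ∑[ j < n ] toℕ (g (i , j))
weight-remQuot {m} {n} g = trans (weight-combine {m} (g ∘ remQuot n))
  (sum-cong-≗ λ i → sum-cong-≗ λ j → cong (toℕ ∘ g) (remQuot-combine i j))

isTwo isOne : Fin 3 → ℕ
isTwo 0F = 0
isTwo 1F = 0
isTwo 2F = 1
isOne 0F = 0
isOne 1F = 1
isOne 2F = 0

toℕ≡2*isTwo+isOne : ∀ x → toℕ x ≡ 2 * isTwo x + isOne x
toℕ≡2*isTwo+isOne 0F = refl
toℕ≡2*isTwo+isOne 1F = refl
toℕ≡2*isTwo+isOne 2F = refl

toℕ≡2⇒isTwo≡1 : ∀ {x} → toℕ x ≡ 2 → isTwo x ≡ 1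
toℕ≡2⇒isTwo≡1 {2F} refl = refl

module Layers (g : Fin (suc m) × Fin n → Fin 3) where

  twos ones layerWeight : Fin (suc m) → ℕ
  twos i = ∑[ j < n ] isTwo (g (i , j))
  ones i = ∑[ j < n ] isOne (g (i , j))
  layerWeight i = ∑[ j < n ] toℕ (g (i , j))

  layerWeight≡ : ∀ i → layerWeight i ≡ 2 * twos i + ones i
  layerWeight≡ i = begin
    ∑[ j < n ] toℕ (g (i , j))                          ≡⟨ sum-cong-≗ (toℕ≡2*isTwo+isOne ∘ g ∘ (i ,_)) ⟩
    ∑[ j < n ] (2 * isTwo (g (i , j)) + isOne (g (i , j))) ≡⟨ ∑-distrib-+ (λ j → 2 * isTwo (g (i , j))) _ ⟩
    ∑[ j < n ] (2 * isTwo (g (i , j))) + ones i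
      ≡⟨ cong (_+ ones i) (*-distribˡ-sum 2 (λ j → isTwo (g (i , j)))) ⟨
    2 * twos i + ones i                                    ∎
    where open ≡-Reasoning

  module _ (dom : RomanDominating (CycleAdj (suc m) □ CompleteAdj n) g) (i : Fin (suc m))
           (noTwos : twos i ≡ 0) where

    column-covered : ∀ j → 1 ≤ isOne (g (i , j)) + isTwo (g (predᶜ i , j)) + isTwo (g (sucᶜ i , j))
    column-covered j with g (i , j) in gij
    ... | 1F = s≤s z≤n
    ... | 2F with () ← trans (cong isTwo (sym gij)) (∑≡0⇒≡0 _ noTwos j)
    ... | 0F with dom (i , j) (cong toℕ gij)
    ... | (.i , v) , inj₁ (refl , _) , giv≡2
          with () ← trans (sym (toℕ≡2⇒isTwo≡1 giv≡2)) (∑≡0⇒≡0 _ noTwos v)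
    ... | (u , .j) , inj₂ (refl , i~u) , guj≡2 with CycleAdj⇒sucᶜ⊎predᶜ i u i~u
    ...   | inj₁ refl = subst (λ x → 1 ≤ isTwo (g (predᶜ i , j)) + x) (sym (toℕ≡2⇒isTwo≡1 guj≡2))
                              (m≤n+m 1 (isTwo (g (predᶜ i , j))))
    ...   | inj₂ refl = subst (λ x → 1 ≤ x + isTwo (g (sucᶜ i , j))) (sym (toℕ≡2⇒isTwo≡1 guj≡2))
                              (s≤s z≤n)

    layer-covered : n ≤ ones i + twos (predᶜ i) + twos (sucᶜ i)
    layer-covered = begin
      n                        ≡⟨ sym (trans (∑-const n 1) (*-identityʳ n)) ⟩
      ∑[ j < n ] 1             ≤⟨ ∑-mono-≤ column-covered ⟩
      ∑[ j < n ] (x j + y j + z j) ≡⟨ ∑-distrib-+ (λ j → x j + y j) z ⟩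
      ∑[ j < n ] (x j + y j) + twos (sucᶜ i) ≡⟨ cong (_+ twos (sucᶜ i)) (∑-distrib-+ x y) ⟩
      ones i + twos (predᶜ i) + twos (sucᶜ i) ∎
      where
        open ≤-Reasoning
        x y z : Fin n → ℕ
        x j = isOne (g (i , j))
        y j = isTwo (g (predᶜ i , j))
        z j = isTwo (g (sucᶜ i , j))

discharging : (w c : Fin (suc m) → ℕ) (k : ℕ) →
  (∀ i → k + 2 * c i ≤ w i + c (predᶜ i) + c (sucᶜ i)) → suc m * k ≤ ∑[ i < suc m ] w i
discharging {m} w c k balance = +-cancelʳ-≤ (2 * C) (suc m * k) W (begin
  suc m * k + 2 * C                                       ≡⟨ cong₂ _+_ (sym (∑-const (suc m) k)) (*-distribˡ-sum 2 c) ⟩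
  ∑[ i < suc m ] k + ∑[ i < suc m ] (2 * c i)             ≡⟨ ∑-distrib-+ (λ _ → k) (λ i → 2 * c i) ⟨
  ∑[ i < suc m ] (k + 2 * c i)                            ≤⟨ ∑-mono-≤ balance ⟩
  ∑[ i < suc m ] (w i + c (predᶜ i) + c (sucᶜ i))         ≡⟨ ∑-distrib-+ (λ i → w i + c (predᶜ i)) (c ∘ sucᶜ) ⟩
  ∑[ i < suc m ] (w i + c (predᶜ i)) + ∑[ i < suc m ] c (sucᶜ i)
                                                          ≡⟨ cong₂ _+_ (∑-distrib-+ w (c ∘ predᶜ)) (∑-sucᶜ c) ⟩
  W + ∑[ i < suc m ] c (predᶜ i) + C                       ≡⟨ cong (λ s → W + s + C) (∑-predᶜ c) ⟩
  W + C + C                                               ≡⟨ +-assoc W C C ⟩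
  W + (C + C)                                             ≡⟨ cong (λ s → W + (C + s)) (+-identityʳ C) ⟨
  W + 2 * C                                               ∎)
  where
    open ≤-Reasoning
    W C : ℕ
    W = ∑[ i < suc m ] w i
    C = ∑[ i < suc m ] c i

balance-K₃ : ∀ a b p q → (a ≡ 0 → 3 ≤ b + p + q) →
  6 + 2 * (4 * a ∸ 3) ≤ 4 * (2 * a + b) + (4 * p ∸ 3) + (4 * q ∸ 3)
balance-K₃ zero b p q covered = +-cancelʳ-≤ 6 6 (4 * b + (4 * p ∸ 3) + (4 * q ∸ 3)) (begin
  12                                            ≤⟨ *-monoʳ-≤ 4 (covered refl) ⟩
  4 * (b + p + q)                               ≡⟨ distrib b p q ⟩
  4 * b + 4 * p + 4 * q
    ≤⟨ +-mono-≤ (+-monoʳ-≤ (4 * b) (m≤n+m∸n (4 * p) 3)) (m≤n+m∸n (4 * q) 3) ⟩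
  4 * b + (3 + (4 * p ∸ 3)) + (3 + (4 * q ∸ 3)) ≡⟨ shuffle (4 * b) (4 * p ∸ 3) (4 * q ∸ 3) ⟩
  4 * b + (4 * p ∸ 3) + (4 * q ∸ 3) + 6         ∎)
  where
    open ≤-Reasoning
    distrib : ∀ b p q → 4 * (b + p + q) ≡ 4 * b + 4 * p + 4 * q
    distrib = solve-∀
    shuffle : ∀ x y z → x + (3 + y) + (3 + z) ≡ x + y + z + 6
    shuffle = solve-∀
balance-K₃ (suc a) b p q _ = begin
  6 + 2 * (4 * suc a ∸ 3)                   ≡⟨ cong (λ x → 6 + 2 * (x ∸ 3)) (*-suc 4 a) ⟩
  6 + 2 * suc (4 * a)                       ≡⟨ regroup a ⟩
  4 * (2 * suc a)                           ≤⟨ *-monoʳ-≤ 4 (m≤m+n (2 * suc a) b) ⟩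
  4 * (2 * suc a + b)                       ≤⟨ m≤m+n _ _ ⟩
  4 * (2 * suc a + b) + (4 * p ∸ 3)         ≤⟨ m≤m+n _ _ ⟩
  4 * (2 * suc a + b) + (4 * p ∸ 3) + (4 * q ∸ 3) ∎
  where
    open ≤-Reasoning
    regroup : ∀ a → 6 + 2 * suc (4 * a) ≡ 4 * (2 * suc a)
    regroup = solve-∀

balance-K≥4 : ∀ a b p q → (a ≡ 0 → 4 ≤ b + p + q) →
  2 + 2 * (a ∸ 1) ≤ (2 * a + b) + (p ∸ 1) + (q ∸ 1)
balance-K≥4 zero b p q covered = +-cancelʳ-≤ 2 2 (b + (p ∸ 1) + (q ∸ 1)) (begin
  4                                 ≤⟨ covered refl ⟩
  b + p + q                         ≤⟨ +-mono-≤ (+-monoʳ-≤ b (m≤n+m∸n p 1)) (m≤n+m∸n q 1) ⟩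
  b + (1 + (p ∸ 1)) + (1 + (q ∸ 1)) ≡⟨ shuffle b (p ∸ 1) (q ∸ 1) ⟩
  b + (p ∸ 1) + (q ∸ 1) + 2         ∎)
  where
    open ≤-Reasoning
    shuffle : ∀ x y z → x + (1 + y) + (1 + z) ≡ x + y + z + 2
    shuffle = solve-∀
balance-K≥4 (suc a) b p q _ = begin
  2 + 2 * a                             ≡⟨ *-suc 2 a ⟨
  2 * suc a                             ≤⟨ m≤m+n _ b ⟩
  2 * suc a + b                         ≤⟨ m≤m+n _ _ ⟩
  2 * suc a + b + (p ∸ 1)               ≤⟨ m≤m+n _ _ ⟩
  2 * suc a + b + (p ∸ 1) + (q ∸ 1)     ∎
  where open ≤-Reasoning

m≤2n⇒⌈m/2⌉≤n : ∀ {m n} → m ≤ 2 * n → ⌈ m /2⌉ ≤ n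
m≤2n⇒⌈m/2⌉≤n {m} {n} m≤2n = begin
  ⌈ m /2⌉     ≤⟨ ⌈n/2⌉-mono (subst (m ≤_) (cong (n +_) (+-identityʳ n)) m≤2n) ⟩
  ⌈ n + n /2⌉ ≡⟨ n≡⌈n+n/2⌉ n ⟨
  n           ∎
  where open ≤-Reasoning

lowerBound-K₃ : (f : Fin (suc m * 3) → Fin 3) → IsRDF (suc m * 3) (CtKn (suc m) 3) f →
  ⌈ 3 * suc m /2⌉ ≤ weight (suc m * 3) f
lowerBound-K₃ {m} f rdf = m≤2n⇒⌈m/2⌉≤n (*-cancelˡ-≤ 2 (begin
  2 * (3 * suc m)                                   ≡⟨ regroup (suc m) ⟩
  suc m * 6                                         ≤⟨ discharging w (λ i → 4 * twos i ∸ 3) 6 balance ⟩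
  ∑[ i < suc m ] w i                                ≡⟨ sum-cong-≗ (cong (4 *_) ∘ sym ∘ layerWeight≡) ⟩
  ∑[ i < suc m ] (4 * layerWeight i)                ≡⟨ *-distribˡ-sum 4 layerWeight ⟨
  4 * ∑[ i < suc m ] layerWeight i                  ≡⟨ cong (4 *_) (weight-combine {suc m} {3} f) ⟨
  4 * weight (suc m * 3) f                          ≡⟨ *-assoc 2 2 (weight (suc m * 3) f) ⟩
  2 * (2 * weight (suc m * 3) f)                    ∎))
  where
    open ≤-Reasoning
    open Layers {m} {3} (f ∘ uncurry combine)
    regroup : ∀ t → 2 * (3 * t) ≡ t * 6
    regroup = solve-∀
    w : Fin (suc m) → ℕ
    w i = 4 * (2 * twos i + ones i)
    balance : ∀ i → 6 + 2 * (4 * twos i ∸ 3) ≤ w i + (4 * twos (predᶜ i) ∸ 3) + (4 * twos (sucᶜ i) ∸ 3)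
    balance i = balance-K₃ (twos i) (ones i) (twos (predᶜ i)) (twos (sucᶜ i))
                           (layer-covered (dominating-combine {suc m} {3} f rdf) i)

lowerBound-K≥4 : 4 ≤ n → (f : Fin (suc m * n) → Fin 3) → IsRDF (suc m * n) (CtKn (suc m) n) f →
  2 * suc m ≤ weight (suc m * n) f
lowerBound-K≥4 {n} {m} n≥4 f rdf = begin
  2 * suc m                             ≡⟨ *-comm 2 (suc m) ⟩
  suc m * 2                             ≤⟨ discharging w (λ i → twos i ∸ 1) 2 balance ⟩
  ∑[ i < suc m ] w i                    ≡⟨ sum-cong-≗ (sym ∘ layerWeight≡) ⟩
  ∑[ i < suc m ] layerWeight i          ≡⟨ weight-combine {suc m} {n} f ⟨
  weight (suc m * n) f                  ∎
  where
    open ≤-Reasoning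
    open Layers {m} {n} (f ∘ uncurry combine)
    w : Fin (suc m) → ℕ
    w i = 2 * twos i + ones i
    balance : ∀ i → 2 + 2 * (twos i ∸ 1) ≤ w i + (twos (predᶜ i) ∸ 1) + (twos (sucᶜ i) ∸ 1)
    balance i = balance-K≥4 (twos i) (ones i) (twos (predᶜ i)) (twos (sucᶜ i))
                            (≤-trans n≥4 ∘ layer-covered (dominating-combine {suc m} {n} f rdf) i)

6+⌈3t/2⌉≡⌈3[4+t]/2⌉ : ∀ t → 6 + ⌈ 3 * t /2⌉ ≡ ⌈ 3 * (4 + t) /2⌉
6+⌈3t/2⌉≡⌈3[4+t]/2⌉ t = cong ⌈_/2⌉ (distrib t)
  where
    distrib : ∀ t → 12 + 3 * t ≡ 3 * (4 + t)
    distrib = solve-∀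

6*[4+t]/4+x≡6+[6*[t/4]+x] : ∀ t x → 6 * ((4 + t) / 4) + x ≡ 6 + (6 * (t / 4) + x)
6*[4+t]/4+x≡6+[6*[t/4]+x] t x = begin
  6 * ((4 + t) / 4) + x   ≡⟨ cong (λ q → 6 * q + x) (m/n≡1+[m∸n]/n {4 + t} {4} (s≤s (s≤s (s≤s (s≤s z≤n))))) ⟩
  6 * suc (t / 4) + x     ≡⟨ cong (_+ x) (*-suc 6 (t / 4)) ⟩
  6 + 6 * (t / 4) + x     ≡⟨ +-assoc 6 (6 * (t / 4)) x ⟩
  6 + (6 * (t / 4) + x)   ∎
  where open ≡-Reasoning

gammaFormula-K₃ : ∀ t → gammaFormula t 3 ≡ ⌈ 3 * t /2⌉
gammaFormula-K₃ 0 = refl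
gammaFormula-K₃ 1 = refl
gammaFormula-K₃ 2 = refl
gammaFormula-K₃ 3 = refl
gammaFormula-K₃ (suc (suc (suc (suc t)))) with t % 4 ≤? 1 | gammaFormula-K₃ t
... | yes _ | ih = begin
  6 * ((4 + t) / 4) + 2 * (t % 4)   ≡⟨ 6*[4+t]/4+x≡6+[6*[t/4]+x] t (2 * (t % 4)) ⟩
  6 + (6 * (t / 4) + 2 * (t % 4))   ≡⟨ cong (6 +_) ih ⟩
  6 + ⌈ 3 * t /2⌉                   ≡⟨ 6+⌈3t/2⌉≡⌈3[4+t]/2⌉ t ⟩
  ⌈ 3 * (4 + t) /2⌉                 ∎
  where open ≡-Reasoning
... | no r≰1 | ih = begin
  6 * ((4 + t) / 4) + 2 * (t % 4) ∸ 1   ≡⟨ cong (_∸ 1) (6*[4+t]/4+x≡6+[6*[t/4]+x] t (2 * (t % 4))) ⟩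
  6 + (6 * (t / 4) + 2 * (t % 4)) ∸ 1   ≡⟨ +-∸-assoc 6 1≤6q+2r ⟩
  6 + (6 * (t / 4) + 2 * (t % 4) ∸ 1)   ≡⟨ cong (6 +_) ih ⟩
  6 + ⌈ 3 * t /2⌉                       ≡⟨ 6+⌈3t/2⌉≡⌈3[4+t]/2⌉ t ⟩
  ⌈ 3 * (4 + t) /2⌉                     ∎
  where
    open ≡-Reasoning
    1≤6q+2r : 1 ≤ 6 * (t / 4) + 2 * (t % 4)
    1≤6q+2r = ≤-trans (<⇒≤ (≰⇒> r≰1)) (≤-trans (m≤m+n (t % 4) _) (m≤n+m _ (6 * (t / 4))))

columnOfTwos : Fin t × Fin (suc n) → Fin 3
columnOfTwos (_ , zero) = 2F
columnOfTwos (_ , suc _) = 0F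

columnOfTwos-dominating : RomanDominating (CycleAdj t □ CompleteAdj (suc n)) columnOfTwos
columnOfTwos-dominating (i , zero) ()
columnOfTwos-dominating (i , suc j) _ = (i , zero) , inj₁ (refl , λ ()) , refl

∑-columnOfTwos : ∑[ i < t ] ∑[ j < suc n ] toℕ (columnOfTwos (i , j)) ≡ 2 * t
∑-columnOfTwos {t} {n} = begin
  ∑[ i < t ] (2 + ∑[ j < n ] 0) ≡⟨ sum-cong-≗ {t} (λ _ → cong (2 +_) (trans (∑-const n 0) (*-zeroʳ n))) ⟩
  ∑[ i < t ] 2                  ≡⟨ ∑-const t 2 ⟩
  t * 2                         ≡⟨ *-comm t 2 ⟩
  2 * t                         ∎
  where open ≡-Reasoning

even : ℕ → Bool
even 0 = true
even 1 = false
even (suc (suc n)) = even n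

even-suc : ∀ n → even (suc n) ≡ not (even n)
even-suc 0 = refl
even-suc 1 = refl
even-suc (suc (suc n)) = even-suc n

even-predᶜ : (i : Fin (suc m)) → even (toℕ i) ≡ false → even (toℕ (predᶜ i)) ≡ true
even-predᶜ (suc i) odd rewrite toℕ-inject₁ i = not-injective (trans (sym (even-suc (toℕ i))) odd)

even-sucᶜ : (i : Fin (suc m)) → even (toℕ i) ≡ false → even (toℕ (sucᶜ i)) ≡ true
even-sucᶜ i odd with view i
... | ‵fromℕ = refl
... | ‵inject₁ j = trans (even-suc (toℕ j)) (cong not (trans (cong even (sym (toℕ-inject₁ j))) odd))

layerCost : ℕ → ℕ
layerCost e = if even e then 2 else 1

∑-layerCost : ∀ t → ∑[ i < t ] layerCost (toℕ i) ≡ ⌈ 3 * t /2⌉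
∑-layerCost 0 = refl
∑-layerCost 1 = refl
∑-layerCost (suc (suc t)) = trans (cong (3 +_) (∑-layerCost t)) (cong ⌈_/2⌉ (distrib t))
  where
    distrib : ∀ t → 6 + 3 * t ≡ 3 * (2 + t)
    distrib = solve-∀

single : Fin 3 → Fin 3 → Fin 3 → Fin 3
single c x j with j ≟ᶠ c
... | yes _ = x
... | no _ = 0F

single-self : ∀ c x → single c x c ≡ x
single-self c x with c ≟ᶠ c
... | yes _ = refl
... | no c≢c = contradiction refl c≢c

single-zero : ∀ c x j → toℕ (single c (suc x) j) ≡ 0 → j ≢ c
single-zero c x j v≡0 with j ≟ᶠ c | v≡0
... | no j≢c | _ = j≢c

∑-single : ∀ c x → ∑[ j < 3 ] toℕ (single c x j) ≡ toℕ x
∑-single 0F x = +-identityʳ (toℕ x)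
∑-single 1F x = +-identityʳ (toℕ x)
∑-single 2F x = +-identityʳ (toℕ x)

third : Fin 3 → Fin 3 → Fin 3
third 0F 1F = 2F
third 1F 0F = 2F
third 0F 2F = 1F
third 2F 0F = 1F
third _ _ = 0F

third-cases : ∀ {a b} j → a ≢ b → j ≢ third a b → j ≡ a ⊎ j ≡ b
third-cases j = toWitness {a? = all? λ a → all? λ b → all? λ j →
    ¬? (a ≟ᶠ b) →-dec (¬? (j ≟ᶠ third a b) →-dec ((j ≟ᶠ a) ⊎-dec (j ≟ᶠ b)))} _ _ _ j

alternating : ℕ → Fin 3
alternating 0 = 0F
alternating 1 = 0F
alternating 2 = 1F
alternating 3 = 1F
alternating (suc (suc (suc (suc e)))) = alternating e

alternating≢2F : ∀ e → alternating e ≢ 2F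
alternating≢2F 0 ()
alternating≢2F 1 ()
alternating≢2F 2 ()
alternating≢2F 3 ()
alternating≢2F (suc (suc (suc (suc e)))) = alternating≢2F e

alternating-flips : ∀ e → alternating e ≢ alternating (2 + e)
alternating-flips 0 ()
alternating-flips 1 ()
alternating-flips 2 ()
alternating-flips 3 ()
alternating-flips (suc (suc (suc (suc e)))) = alternating-flips e

-- The 2 of the even copy e sits in column alternating e, except in the last even copy
-- (t ≤ 2 + e), where it sits in column 2: then the 2s flanking every odd copy, also
-- across the wrap-around t - 1 ~ 0, lie in different columns.
column : ℕ → ℕ → Fin 3
column t e with t ≤? 2 + e
... | yes _ = 2F
... | no _ = alternating e

column-last : ∀ e → column (2 + e) e ≡ 2F
column-last e with 2 + e ≤? 2 + e
... | yes _ = refl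
... | no 2+e≰2+e = contradiction ≤-refl 2+e≰2+e

column-first : 3 ≤ t → column t 0 ≡ 0F
column-first {t} 3≤t with t ≤? 2
... | yes t≤2 = contradiction t≤2 (<⇒≱ 3≤t)
... | no _ = refl

column-flips : ∀ {t} e → 3 + e ≤ t → column t e ≢ column t (2 + e)
column-flips {t} e 3+e≤t with t ≤? 2 + e | t ≤? 2 + (2 + e)
... | yes t≤2+e | _ = contradiction t≤2+e (<⇒≱ 3+e≤t)
... | no _ | yes _ = alternating≢2F e
... | no _ | no _ = alternating-flips e

columns-around-odd : 3 ≤ suc m → (i : Fin (suc m)) → even (toℕ i) ≡ false →
  column (suc m) (toℕ (predᶜ i)) ≢ column (suc m) (toℕ (sucᶜ i))
columns-around-odd {zero} (s≤s ())
columns-around-odd {suc m} 3≤t i odd with view i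
... | ‵fromℕ rewrite toℕ-inject₁ (fromℕ m) | toℕ-fromℕ m | column-last m | column-first 3≤t = λ ()
... | ‵inject₁ zero with () ← odd
... | ‵inject₁ (suc j) rewrite toℕ-inject₁ (inject₁ j) | toℕ-inject₁ j =
  column-flips (toℕ j) (toℕ<n (suc (suc j)))

module Layered (col : Fin (suc m) → Fin 3) where

  layered : Fin (suc m) × Fin 3 → Fin 3
  layered (i , j) =
    if even (toℕ i) then single (col i) 2F j else single (third (col (predᶜ i)) (col (sucᶜ i))) 1F j

  layered-even : ∀ i → even (toℕ i) ≡ true → toℕ (layered (i , col i)) ≡ 2
  layered-even i ev rewrite ev | single-self (col i) 2F = refl

  layered-dominating : (∀ i → even (toℕ i) ≡ false → col (predᶜ i) ≢ col (sucᶜ i)) →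
    RomanDominating (CycleAdj (suc m) □ CompleteAdj 3) layered
  layered-dominating separated (i , j) v≡0 with even (toℕ i) in parity
  ... | true = (i , col i) , inj₁ (refl , single-zero (col i) 1F j v≡0) , layered-even i parity
  ... | false with third-cases j (separated i parity) (single-zero _ 0F j v≡0)
  ...   | inj₁ refl = (predᶜ i , col (predᶜ i)) , inj₂ (refl , CycleAdj-predᶜ i) ,
                      layered-even (predᶜ i) (even-predᶜ i parity)
  ...   | inj₂ refl = (sucᶜ i , col (sucᶜ i)) , inj₂ (refl , CycleAdj-sucᶜ i) ,
                      layered-even (sucᶜ i) (even-sucᶜ i parity)

  ∑-layered : ∀ i → ∑[ j < 3 ] toℕ (layered (i , j)) ≡ layerCost (toℕ i)
  ∑-layered i with even (toℕ i)
  ... | true = ∑-single (col i) 2F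
  ... | false = ∑-single (third (col (predᶜ i)) (col (sucᶜ i))) 1F

upperBound-K₃ : 3 ≤ suc m →
  ∃[ f ] (IsRDF (suc m * 3) (CtKn (suc m) 3) f × weight (suc m * 3) f ≡ ⌈ 3 * suc m /2⌉)
upperBound-K₃ {m} 3≤t =
  layered ∘ remQuot 3 ,
  dominating-remQuot layered (layered-dominating (columns-around-odd 3≤t)) ,
  trans (weight-remQuot layered) (trans (sum-cong-≗ ∑-layered) (∑-layerCost (suc m)))
  where open Layered (column (suc m) ∘ toℕ)

upperBound-columnOfTwos : ∃[ f ] (IsRDF (t * suc n) (CtKn t (suc n)) f × weight (t * suc n) f ≡ 2 * t)
upperBound-columnOfTwos {t} {n} =
  columnOfTwos {t} ∘ remQuot (suc n) ,
  dominating-remQuot columnOfTwos columnOfTwos-dominating ,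
  trans (weight-remQuot {t} columnOfTwos) (∑-columnOfTwos {t} {n})

proposition3 : (t n : ℕ) → 3 ≤ t → 3 ≤ n →
    IsRomanDominationNumber (t * n) (CtKn t n) (gammaFormula t n)
proposition3 (suc m) 1 _ (s≤s ())
proposition3 (suc m) 2 _ (s≤s (s≤s ()))
proposition3 (suc m) 3 3≤t _ rewrite gammaFormula-K₃ (suc m) = upperBound-K₃ 3≤t , lowerBound-K₃
proposition3 (suc m) (suc (suc (suc (suc n)))) _ _ = upperBound-columnOfTwos , lowerBound-K≥4 (m≤m+n 4 n)
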